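{- Let $k \ge 1$ be an integer and let $G$ be a $k$-regular graph of order $n$. Then $\Psi_g^+(G) \ge \frac{1}{2}n$ and $\Psi_g^-(G) \ge \frac{1}{2}n$.
   Context: All graphs are finite and simple. For a set $S$ of vertices of a graph $G$, a vertex $v \in S$ is an enclave of $S$ if $v$ and all its neighbors lie in $S$ (i.e. $N[v] \subseteq S$); $S$ is enclaveless if it contains no enclave. The competition-enclaveless game on $G$ is played by two players, Maximizer and Minimizer, who alternately choose a vertex $v$ not in the set $S$ of previously chosen vertices such that $S \cup \{v\}$ is enclaveless; the game ends when no such vertex exists (so the final $S$ is a maximal enclaveless set). Maximizer aims to maximize and Minimizer to minimize the final $|S|$. $\Psi_g^+(G)$ is the final $|S|$ when Maximizer moves first and both play optimally; $\Psi_g^-(G)$ is the same quantity when Minimizer moves first. -}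

module Defs where

open import Data.Nat using (ℕ; zero; suc; _⊔_; _⊓_)
open import Data.Bool using (Bool; true; false; _∧_; _∨_; not; if_then_else_; T)
open import Data.Fin using (Fin; _≟_)
open import Data.Fin.Subset using (Subset; ∣_∣)
open import Data.Vec using (Vec; lookup; tabulate)
open import Data.List using (List; []; _∷_; map; filter; foldr; allFin)
open import Relation.Nullary using (¬_; does)
open import Relation.Binary.PropositionalEquality using (_≡_)

record Graph (n : ℕ) : Set where
  field
    adj    : Fin n → Fin n → Bool
    sym    : ∀ u v → adj u v ≡ adj v u
    irrefl : ∀ v → adj v v ≡ false
open Graph public

degree : ∀ {n} → Graph n → Fin n → ℕ
degree G v = ∣ tabulate (adj G v) ∣

Regular : ∀ {n} → ℕ → Graph n → Set
Regular k G = ∀ v → degree G v ≡ k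

allᵇ : {A : Set} → (A → Bool) → List A → Bool
allᵇ p []       = true
allᵇ p (x ∷ xs) = p x ∧ allᵇ p xs

_∈ᵇ_ : ∀ {n} → Fin n → Subset n → Bool
v ∈ᵇ S = lookup S v

insert : ∀ {n} → Fin n → Subset n → Subset n
insert v S = tabulate (λ u → does (u ≟ v) ∨ (u ∈ᵇ S))

isEnclave : ∀ {n} → Graph n → Subset n → Fin n → Bool
isEnclave {n} G S v = (v ∈ᵇ S) ∧ allᵇ (λ u → not (adj G v u) ∨ (u ∈ᵇ S)) (allFin n)

enclaveless : ∀ {n} → Graph n → Subset n → Bool
enclaveless {n} G S = allᵇ (λ v → not (isEnclave G S v)) (allFin n)

legal : ∀ {n} → Graph n → Subset n → Fin n → Bool
legal G S v = not (v ∈ᵇ S) ∧ enclaveless G (insert v S)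

legalMoves : ∀ {n} → Graph n → Subset n → List (Fin n)
legalMoves {n} G S = filter (λ v → T? (legal G S v)) (allFin n)
  where
  open import Data.Bool.Properties using () renaming (T? to T?)

data Player : Set where
  Maximizer Minimizer : Player

other : Player → Player
other Maximizer = Minimizer
other Minimizer = Maximizer

-- The fuel bounds the number of remaining moves; every move adds a new vertex,
-- so starting from ∅ with fuel n the fuel never runs out before the game ends.
value : ∀ {n} → Graph n → ℕ → Player → Subset n → ℕ
value G zero    p S = ∣ S ∣
value G (suc f) p S with map (λ v → value G f (other p) (insert v S)) (legalMoves G S)
... | []     = ∣ S ∣
... | x ∷ xs with p
...   | Maximizer = foldr _⊔_ x xs
...   | Minimizer = foldr _⊓_ x xs

emptySet : ∀ {n} → Subset n
emptySet = tabulate (λ _ → false)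

Ψ⁺ : ∀ {n} → Graph n → ℕ
Ψ⁺ {n} G = value G n Maximizer emptySet

Ψ⁻ : ∀ {n} → Graph n → ℕ
Ψ⁻ {n} G = value G n Minimizer emptySet

-- A maximal enclaveless set S of a k-regular graph has at least n/2 vertices, and the game always
-- ends in a maximal enclaveless set. A vertex v ∉ S is blocked by an enclave of S ∪ {v}: either all
-- neighbours of v lie in S, or v is the only neighbour outside S of some w ∈ S. Discharge: a vertex
-- v ∉ S of the first kind receives 1 from each of its k neighbours, one of the second kind receives k
-- from such a w. A vertex of S sends at most k in total, since it either has a single neighbour
-- outside S or sends at most 1 along each of its k edges. Hence k ∣V ∖ S∣ ≤ k ∣S∣.

module Submission where

open import Algebra.Definitions using (Selective)
open import Data.Bool using (Bool; true; false; _∧_; _∨_; not; if_then_else_)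
open import Data.Bool.Properties
  using (¬-not; T?; T-≡; ∧-conicalˡ; ∧-conicalʳ; ∨-conicalˡ; ∨-conicalʳ; not-injective)
  renaming (_≟_ to _≟ᵇ_)
open import Data.Empty using (⊥-elim)
open import Data.Fin using (Fin; zero; suc; _≟_)
open import Data.Fin.Properties using (suc-injective)
open import Data.Fin.Subset using (Subset; ∣_∣; ∁)
open import Data.Fin.Subset.Properties using (∣p∣≤n; ∣∁p∣≡n∸∣p∣; ∣p∣≡n⇒p≡⊤)
open import Data.List using ([]; _∷_; map; foldr; allFin)
open import Data.List.Membership.Propositional using (_∈_)
open import Data.List.Membership.Propositional.Properties
  using (∈-allFin; ∈-map⁺; ∈-map⁻; ∈-filter⁺; ∈-filter⁻; foldr-selective)
open import Data.List.Relation.Unary.Any using (here; there)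
open import Data.Nat using (ℕ; zero; suc; _+_; _*_; _∸_; _≤_; _⊔_; _⊓_; z≤n; >-nonZero)
open import Data.Nat.Properties
  using ( +-*-semiring; module ≤-Reasoning; ≤-refl; ≤-reflexive; ≤-trans; ≤-antisym
        ; +-identityʳ; +-suc; +-mono-≤; +-monoʳ-≤; m≤m+n; m≤n+m; m+[n∸m]≡n
        ; *-comm; *-identityˡ; *-identityʳ; *-zeroʳ; *-monoʳ-≤; *-cancelˡ-≤; ⊔-sel; ⊓-sel)
open import Data.Product using (_×_; _,_; ∃; proj₂)
open import Data.Sum using (_⊎_; inj₁; inj₂; [_,_]′)
open import Data.Vec using (Vec; lookup; tabulate)
open import Data.Vec.Properties using (lookup∘tabulate; lookup-map; lookup-replicate)
open import Defs hiding (sym)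
open import Function using (_∘_; id; Equivalence)
open import Relation.Binary.PropositionalEquality
open import Relation.Nullary using (Dec; does; yes; no)
open import Relation.Nullary.Decidable using (dec-true; dec-false)

open import Algebra.Properties.Semiring.Sum +-*-semiring
  using ( sum; sum-syntax; sum-cong-≗; sum-replicate-zero; ∑-distrib-+; ∑-comm
        ; *-distribˡ-sum; *-distribʳ-sum)

true≢false : true ≢ false
true≢false ()

χ : Bool → ℕ
χ true  = 1
χ false = 0

χ-∧≤ : ∀ a b → χ (a ∧ b) ≤ χ a
χ-∧≤ true  true  = ≤-refl
χ-∧≤ true  false = z≤n
χ-∧≤ false b     = z≤n

sum-mono-≤ : ∀ {n} {f g : Fin n → ℕ} → (∀ i → f i ≤ g i) → sum f ≤ sum g
sum-mono-≤ {zero}  f≤g = z≤n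
sum-mono-≤ {suc n} f≤g = +-mono-≤ (f≤g zero) (sum-mono-≤ (f≤g ∘ suc))

term≤sum : ∀ {n} (f : Fin n → ℕ) i → f i ≤ sum f
term≤sum f zero    = m≤m+n (f zero) _
term≤sum f (suc i) = ≤-trans (term≤sum (f ∘ suc) i) (m≤n+m _ (f zero))

sum-single : ∀ {n} (f : Fin n → ℕ) i → (∀ j → j ≢ i → f j ≡ 0) → sum f ≡ f i
sum-single {suc n} f zero zeros = begin
  f zero + sum (f ∘ suc)        ≡⟨ cong (f zero +_) (sum-cong-≗ (λ j → zeros (suc j) (λ ()))) ⟩
  f zero + sum (λ (_ : Fin n) → 0) ≡⟨ cong (f zero +_) (sum-replicate-zero n) ⟩
  f zero + 0                    ≡⟨ +-identityʳ (f zero) ⟩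
  f zero                        ∎
  where open ≡-Reasoning
sum-single {suc n} f (suc i) zeros =
  trans (cong (_+ sum (f ∘ suc)) (zeros zero (λ ())))
        (sum-single (f ∘ suc) i (λ j j≢i → zeros (suc j) (j≢i ∘ suc-injective)))

∣p∣≡∑χ : ∀ {n} (p : Subset n) → ∣ p ∣ ≡ ∑[ i < n ] χ (lookup p i)
∣p∣≡∑χ Vec.[]          = refl
∣p∣≡∑χ (true Vec.∷ p)  = cong suc (∣p∣≡∑χ p)
∣p∣≡∑χ (false Vec.∷ p) = ∣p∣≡∑χ p

module _ {A : Set} (p : A → Bool) where

  allᵇ-true⁺ : ∀ xs → (∀ x → p x ≡ true) → allᵇ p xs ≡ true
  allᵇ-true⁺ []       all = refl
  allᵇ-true⁺ (x ∷ xs) all rewrite all x = allᵇ-true⁺ xs all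

  allᵇ-true⁻ : ∀ {xs} → allᵇ p xs ≡ true → ∀ {x} → x ∈ xs → p x ≡ true
  allᵇ-true⁻ {y ∷ ys} all (here refl) = ∧-conicalˡ (p y) _ all
  allᵇ-true⁻ {y ∷ ys} all (there x∈) = allᵇ-true⁻ (∧-conicalʳ (p y) _ all) x∈

  allᵇ-false⁻ : ∀ xs → allᵇ p xs ≡ false → ∃ λ x → p x ≡ false
  allᵇ-false⁻ (x ∷ xs) none with p x in px
  ... | true  = allᵇ-false⁻ xs none
  ... | false = x , px

module _ {n : ℕ} (G : Graph n) where

  neighboursIn : Subset n → Fin n → Bool
  neighboursIn S v = allᵇ (λ u → not (adj G v u) ∨ u ∈ᵇ S) (allFin n)

  neighboursIn⁺ : ∀ S {v} → (∀ u → adj G v u ≡ true → u ∈ᵇ S ≡ true) → neighboursIn S v ≡ true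
  neighboursIn⁺ S {v} inside = allᵇ-true⁺ _ (allFin n) implication
    where
    implication : ∀ u → (not (adj G v u) ∨ u ∈ᵇ S) ≡ true
    implication u with adj G v u in uv
    ... | false = refl
    ... | true  = inside u uv

  neighboursIn⁻ : ∀ S {v u} → neighboursIn S v ≡ true → adj G v u ≡ true → u ∈ᵇ S ≡ true
  neighboursIn⁻ S {v} {u} inside uv
    with allᵇ-true⁻ (λ u → not (adj G v u) ∨ u ∈ᵇ S) inside (∈-allFin u)
  ... | implication rewrite uv = implication

  neighboursIn-false⁻ : ∀ S {v} → neighboursIn S v ≡ false →
                        ∃ λ u → adj G v u ≡ true × u ∈ᵇ S ≡ false
  neighboursIn-false⁻ S {v} notInside with allᵇ-false⁻ _ (allFin n) notInside
  ... | u , e = u , not-injective (∨-conicalˡ (not (adj G v u)) _ e) , ∨-conicalʳ _ _ e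

  ∣insert∣ : ∀ (v : Fin n) S → v ∈ᵇ S ≡ false → ∣ insert v S ∣ ≡ suc ∣ S ∣
  ∣insert∣ v S v∉S = begin
    ∣ insert v S ∣                                     ≡⟨ ∣p∣≡∑χ (insert v S) ⟩
    ∑[ u < n ] χ (u ∈ᵇ insert v S)                    ≡⟨ sum-cong-≗ split ⟩
    ∑[ u < n ] (χ (does (u ≟ v)) + χ (u ∈ᵇ S))
      ≡⟨ ∑-distrib-+ (λ u → χ (does (u ≟ v))) (λ u → χ (u ∈ᵇ S)) ⟩
    ∑[ u < n ] χ (does (u ≟ v)) + ∑[ u < n ] χ (u ∈ᵇ S)
      ≡⟨ cong₂ _+_ (sum-single (λ u → χ (does (u ≟ v))) v
                                 (λ u u≢v → cong χ (dec-false (u ≟ v) u≢v)))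
                   (sym (∣p∣≡∑χ S)) ⟩
    χ (does (v ≟ v)) + ∣ S ∣                          ≡⟨ cong (λ b → χ b + ∣ S ∣) (dec-true (v ≟ v) refl) ⟩
    suc ∣ S ∣                                          ∎
    where
    open ≡-Reasoning
    split : ∀ u → χ (u ∈ᵇ insert v S) ≡ χ (does (u ≟ v)) + χ (u ∈ᵇ S)
    split u rewrite lookup∘tabulate (λ u → does (u ≟ v) ∨ u ∈ᵇ S) u with u ≟ v
    ... | yes refl rewrite v∉S = refl
    ... | no _     = refl

  ∈-insert⁻ : ∀ (v : Fin n) S {u} → u ∈ᵇ insert v S ≡ true → u ≡ v ⊎ u ∈ᵇ S ≡ true
  ∈-insert⁻ v S {u} u∈ rewrite lookup∘tabulate (λ u → does (u ≟ v) ∨ u ∈ᵇ S) u with u ≟ v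
  ... | yes u≡v = inj₁ u≡v
  ... | no _    = inj₂ u∈

  enclaveless-∅ : enclaveless G emptySet ≡ true
  enclaveless-∅ = allᵇ-true⁺ _ (allFin n) λ v →
    cong (λ b → not (b ∧ neighboursIn emptySet v)) (lookup∘tabulate (λ _ → false) v)

  enclaveless⇒outsideNeighbour : ∀ S → enclaveless G S ≡ true → ∀ {w} → w ∈ᵇ S ≡ true →
                                 ∃ λ u → adj G w u ≡ true × u ∈ᵇ S ≡ false
  enclaveless⇒outsideNeighbour S noEnclave {w} w∈S = neighboursIn-false⁻ S
    (not-injective (subst (λ b → not (b ∧ neighboursIn S w) ≡ true) w∈S
      (allᵇ-true⁻ (λ v → not (isEnclave G S v)) noEnclave (∈-allFin w))))

  full⇒noLegalMove : ∀ S → n ≤ ∣ S ∣ → ∀ v → legal G S v ≡ false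
  full⇒noLegalMove S full v = cong (λ b → not b ∧ enclaveless G (insert v S)) v∈S
    where
    v∈S : v ∈ᵇ S ≡ true
    v∈S = trans (cong (λ X → lookup X v) (∣p∣≡n⇒p≡⊤ {p = S} (≤-antisym (∣p∣≤n S) full)))
                (lookup-replicate v true)

  MaximalEnclaveless : Subset n → Set
  MaximalEnclaveless S = enclaveless G S ≡ true × (∀ v → legal G S v ≡ false)

  data Covered (S : Subset n) (v : Fin n) : Set where
    enclosed : (∀ u → adj G v u ≡ true → u ∈ᵇ S ≡ true) → Covered S v
    soleExternalNeighbourOf : ∀ {w} → w ∈ᵇ S ≡ true → adj G w v ≡ true →
                              (∀ x → adj G w x ≡ true → x ∈ᵇ S ≡ false → x ≡ v) → Covered S v

  adj⇒≢ : ∀ {u v} → adj G v u ≡ true → u ≢ v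
  adj⇒≢ {u} vu refl = true≢false (trans (sym vu) (irrefl G u))

  enclave⇒covered : ∀ S (v : Fin n) {w} → enclaveless G S ≡ true →
                    isEnclave G (insert v S) w ≡ true → Covered S v
  enclave⇒covered S v {w} noEnclave enclave = cover (w ≟ v)
    where
    closed : ∀ {u} → adj G w u ≡ true → u ≡ v ⊎ u ∈ᵇ S ≡ true
    closed wu = ∈-insert⁻ v S (neighboursIn⁻ (insert v S) (∧-conicalʳ _ _ enclave) wu)
    cover : Dec (w ≡ v) → Covered S v
    cover (yes w≡v) = enclosed λ u vu →
      let wu = subst (λ x → adj G x u ≡ true) (sym w≡v) vu
      in [ ⊥-elim ∘ adj⇒≢ vu , id ]′ (closed wu)
    cover (no w≢v) = soleExternalNeighbourOf w∈S wv sole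
      where
      w∈S : w ∈ᵇ S ≡ true
      w∈S = [ ⊥-elim ∘ w≢v , id ]′ (∈-insert⁻ v S (∧-conicalˡ _ _ enclave))
      sole : ∀ x → adj G w x ≡ true → x ∈ᵇ S ≡ false → x ≡ v
      sole x wx x∉S = [ id , (λ x∈S → ⊥-elim (true≢false (trans (sym x∈S) x∉S))) ]′ (closed wx)
      wv : adj G w v ≡ true
      wv with enclaveless⇒outsideNeighbour S noEnclave w∈S
      ... | u , wu , u∉S = subst (λ x → adj G w x ≡ true) (sole u wu u∉S) wu

  maximal⇒covered : ∀ S → MaximalEnclaveless S → ∀ {v} → v ∈ᵇ S ≡ false → Covered S v
  maximal⇒covered S (noEnclave , maximal) {v} v∉S
    with allᵇ-false⁻ (λ w → not (isEnclave G (insert v S) w)) (allFin n)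
           (subst (λ b → (not b ∧ enclaveless G (insert v S)) ≡ false) v∉S (maximal v))
  ... | w , e = enclave⇒covered S v noEnclave (not-injective e)

degree≡∑χ : ∀ {n} (G : Graph n) v → degree G v ≡ ∑[ u < n ] χ (adj G v u)
degree≡∑χ G v = trans (∣p∣≡∑χ (tabulate (adj G v))) (sum-cong-≗ (cong χ ∘ lookup∘tabulate (adj G v)))

module HalfBound {n k : ℕ} (G : Graph n) (k≥1 : 1 ≤ k) (regular : Regular k G)
                 (S : Subset n) (covered : ∀ v → v ∈ᵇ S ≡ false → Covered G S v) where

  outside : Fin n → Bool
  outside v = not (v ∈ᵇ S)

  outDegree : Fin n → ℕ
  outDegree u = ∑[ x < n ] χ (adj G u x ∧ outside x)

  bonus : ℕ → ℕ
  bonus 1 = k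
  bonus _ = 0

  rate : Fin n → Fin n → ℕ
  rate u v = if neighboursIn G S v then 1 else bonus (outDegree u)

  charge : Fin n → Fin n → ℕ
  charge u v = χ (adj G u v ∧ outside v) * rate u v

  chargeOut : Fin n → ℕ
  chargeOut u = ∑[ v < n ] charge u v

  chargeIn : Fin n → ℕ
  chargeIn v = ∑[ u < n ] (χ (u ∈ᵇ S) * charge u v)

  ∑χ-adj≡k : ∀ v → ∑[ u < n ] χ (adj G v u) ≡ k
  ∑χ-adj≡k v = trans (sym (degree≡∑χ G v)) (regular v)

  rate≤k : ∀ u v → rate u v ≤ k
  rate≤k u v with neighboursIn G S v | outDegree u
  ... | true  | _           = k≥1
  ... | false | 0           = z≤n
  ... | false | 1           = ≤-refl
  ... | false | suc (suc _) = z≤n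

  ≡1⊎bonus≡0 : ∀ m → m ≡ 1 ⊎ bonus m ≡ 0
  ≡1⊎bonus≡0 0             = inj₂ refl
  ≡1⊎bonus≡0 1             = inj₁ refl
  ≡1⊎bonus≡0 (suc (suc _)) = inj₂ refl

  chargeOut≤k : ∀ u → chargeOut u ≤ k
  chargeOut≤k u = [ singleOutside , noBonus ]′ (≡1⊎bonus≡0 (outDegree u))
    where
    open ≤-Reasoning
    edge : Fin n → ℕ
    edge v = χ (adj G u v ∧ outside v)

    singleOutside : outDegree u ≡ 1 → chargeOut u ≤ k
    singleOutside deg = begin
      chargeOut u                ≤⟨ sum-mono-≤ (λ v → *-monoʳ-≤ (edge v) (rate≤k u v)) ⟩
      ∑[ v < n ] (edge v * k)    ≡⟨ *-distribʳ-sum k edge ⟨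
      outDegree u * k            ≡⟨ cong (_* k) deg ⟩
      1 * k                      ≡⟨ *-identityˡ k ⟩
      k                          ∎

    rate≤1 : bonus (outDegree u) ≡ 0 → ∀ v → rate u v ≤ 1
    rate≤1 none v with neighboursIn G S v
    ... | true  = ≤-refl
    ... | false = subst (_≤ 1) (sym none) z≤n

    charge≤χ-adj : bonus (outDegree u) ≡ 0 → ∀ v → charge u v ≤ χ (adj G u v)
    charge≤χ-adj none v = begin
      edge v * rate u v          ≤⟨ *-monoʳ-≤ (edge v) (rate≤1 none v) ⟩
      edge v * 1                 ≡⟨ *-identityʳ (edge v) ⟩
      edge v                     ≤⟨ χ-∧≤ (adj G u v) (outside v) ⟩
      χ (adj G u v)              ∎

    noBonus : bonus (outDegree u) ≡ 0 → chargeOut u ≤ k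
    noBonus none = begin
      chargeOut u                ≤⟨ sum-mono-≤ (charge≤χ-adj none) ⟩
      ∑[ v < n ] χ (adj G u v)   ≡⟨ ∑χ-adj≡k u ⟩
      k                          ∎

  k≤chargeIn-enclosed : ∀ v → v ∈ᵇ S ≡ false → neighboursIn G S v ≡ true → k ≤ chargeIn v
  k≤chargeIn-enclosed v v∉S nb = begin
    k                          ≡⟨ ∑χ-adj≡k v ⟨
    ∑[ u < n ] χ (adj G v u)   ≤⟨ sum-mono-≤ fromNeighbour ⟩
    chargeIn v                 ∎
    where
    open ≤-Reasoning
    fromNeighbour : ∀ u → χ (adj G v u) ≤ χ (u ∈ᵇ S) * charge u v
    fromNeighbour u with adj G v u in vu
    ... | false = z≤n
    ... | true rewrite neighboursIn⁻ G S nb vu | trans (Graph.sym G u v) vu | v∉S | nb = ≤-refl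

  k≤chargeIn-sole : ∀ v {w} → v ∈ᵇ S ≡ false → neighboursIn G S v ≡ false →
                    w ∈ᵇ S ≡ true → adj G w v ≡ true →
                    (∀ x → adj G w x ≡ true → x ∈ᵇ S ≡ false → x ≡ v) → k ≤ chargeIn v
  k≤chargeIn-sole v {w} v∉S nb w∈S wv sole = begin
    k                          ≡⟨ fromW ⟨
    χ (w ∈ᵇ S) * charge w v    ≤⟨ term≤sum (λ u → χ (u ∈ᵇ S) * charge u v) w ⟩
    chargeIn v                 ∎
    where
    open ≤-Reasoning
    onlyAtV : ∀ x → x ≢ v → χ (adj G w x ∧ outside x) ≡ 0
    onlyAtV x x≢v with adj G w x in wx | x ∈ᵇ S in xS
    ... | false | _     = refl
    ... | true  | true  = refl
    ... | true  | false = ⊥-elim (x≢v (sole x wx xS))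
    single : outDegree w ≡ 1
    single = trans (sum-single (λ x → χ (adj G w x ∧ outside x)) v onlyAtV)
                   (cong₂ (λ a b → χ (a ∧ not b)) wv v∉S)
    fromW : χ (w ∈ᵇ S) * charge w v ≡ k
    fromW rewrite w∈S | wv | v∉S | nb | single = trans (+-identityʳ _) (+-identityʳ k)

  k≤chargeIn : ∀ v → v ∈ᵇ S ≡ false → k ≤ chargeIn v
  k≤chargeIn v v∉S with neighboursIn G S v ≟ᵇ true | covered v v∉S
  ... | yes nb | _               = k≤chargeIn-enclosed v v∉S nb
  ... | no ¬nb | enclosed inside = ⊥-elim (¬nb (neighboursIn⁺ G S inside))
  ... | no ¬nb | soleExternalNeighbourOf w∈S wv sole =
    k≤chargeIn-sole v v∉S (¬-not ¬nb) w∈S wv sole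

  k*χ-outside≤chargeIn : ∀ v → k * χ (outside v) ≤ chargeIn v
  k*χ-outside≤chargeIn v with v ∈ᵇ S ≟ᵇ true
  ... | yes v∈S = ≤-trans (≤-reflexive (trans (cong (λ b → k * χ (not b)) v∈S) (*-zeroʳ k))) z≤n
  ... | no v∉S  = ≤-trans (≤-reflexive (trans (cong (λ b → k * χ (not b)) (¬-not v∉S)) (*-identityʳ k)))
                          (k≤chargeIn v (¬-not v∉S))

  ∑chargeIn≡∑chargeOut : ∑[ v < n ] chargeIn v ≡ ∑[ u < n ] (χ (u ∈ᵇ S) * chargeOut u)
  ∑chargeIn≡∑chargeOut = begin
    ∑[ v < n ] ∑[ u < n ] (χ (u ∈ᵇ S) * charge u v)
      ≡⟨ ∑-comm (λ v u → χ (u ∈ᵇ S) * charge u v) ⟩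
    ∑[ u < n ] ∑[ v < n ] (χ (u ∈ᵇ S) * charge u v)
      ≡⟨ sum-cong-≗ (λ u → *-distribˡ-sum (χ (u ∈ᵇ S)) (charge u)) ⟨
    ∑[ u < n ] (χ (u ∈ᵇ S) * chargeOut u)
      ∎
    where open ≡-Reasoning

  k*∣∁S∣≤k*∣S∣ : k * ∣ ∁ S ∣ ≤ k * ∣ S ∣
  k*∣∁S∣≤k*∣S∣ = begin
    k * ∣ ∁ S ∣
      ≡⟨ cong (k *_) (trans (∣p∣≡∑χ (∁ S)) (sum-cong-≗ (λ v → cong χ (lookup-map v not S)))) ⟩
    k * ∑[ v < n ] χ (outside v)            ≡⟨ *-distribˡ-sum k (χ ∘ outside) ⟩
    ∑[ v < n ] (k * χ (outside v))          ≤⟨ sum-mono-≤ k*χ-outside≤chargeIn ⟩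
    ∑[ v < n ] chargeIn v                   ≡⟨ ∑chargeIn≡∑chargeOut ⟩
    ∑[ u < n ] (χ (u ∈ᵇ S) * chargeOut u)   ≤⟨ sum-mono-≤ (λ u → *-monoʳ-≤ (χ (u ∈ᵇ S)) (chargeOut≤k u)) ⟩
    ∑[ u < n ] (χ (u ∈ᵇ S) * k)             ≡⟨ *-distribʳ-sum k (λ u → χ (u ∈ᵇ S)) ⟨
    ∑[ u < n ] χ (u ∈ᵇ S) * k               ≡⟨ cong (_* k) (∣p∣≡∑χ S) ⟨
    ∣ S ∣ * k                               ≡⟨ *-comm ∣ S ∣ k ⟩
    k * ∣ S ∣                               ∎
    where open ≤-Reasoning

  n≤2∣S∣ : n ≤ 2 * ∣ S ∣
  n≤2∣S∣ = begin
    n                       ≡⟨ m+[n∸m]≡n (∣p∣≤n S) ⟨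
    ∣ S ∣ + (n ∸ ∣ S ∣)     ≡⟨ cong (∣ S ∣ +_) (∣∁p∣≡n∸∣p∣ S) ⟨
    ∣ S ∣ + ∣ ∁ S ∣         ≤⟨ +-monoʳ-≤ ∣ S ∣ (*-cancelˡ-≤ k {{>-nonZero k≥1}} k*∣∁S∣≤k*∣S∣) ⟩
    ∣ S ∣ + ∣ S ∣           ≡⟨ cong (∣ S ∣ +_) (+-identityʳ ∣ S ∣) ⟨
    2 * ∣ S ∣               ∎
    where open ≤-Reasoning

maximalEnclaveless⇒half : ∀ {n k} (G : Graph n) → 1 ≤ k → Regular k G →
                          ∀ S → MaximalEnclaveless G S → n ≤ 2 * ∣ S ∣
maximalEnclaveless⇒half G k≥1 regular S maximal =
  HalfBound.n≤2∣S∣ G k≥1 regular S (λ v → maximal⇒covered G S maximal)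

foldr-selective-∈ : ∀ {A : Set} {_•_ : A → A → A} → Selective _≡_ _•_ →
                    ∀ x xs → foldr _•_ x xs ∈ x ∷ xs
foldr-selective-∈ sel x xs = [ here , there ]′ (foldr-selective sel x xs)

module _ {n : ℕ} (G : Graph n) where

  successors-satisfy : ∀ (P : ℕ → Set) f p S →
                       (∀ v → legal G S v ≡ true → P (value G f (other p) (insert v S))) →
                       ∀ {y} → y ∈ map (λ v → value G f (other p) (insert v S)) (legalMoves G S) → P y
  successors-satisfy P f p S move y∈ with ∈-map⁻ _ y∈
  ... | v , v∈ , refl =
    move v (Equivalence.to T-≡ (proj₂ (∈-filter⁻ (λ v → T? (legal G S v)) {xs = allFin n} v∈)))

  value-suc-elim : ∀ (P : ℕ → Set) f p S →
                   ((∀ v → legal G S v ≡ false) → P ∣ S ∣) →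
                   (∀ v → legal G S v ≡ true → P (value G f (other p) (insert v S))) →
                   P (value G (suc f) p S)
  value-suc-elim P f p S stop move
    with map (λ v → value G f (other p) (insert v S)) (legalMoves G S) in outcomes
  ... | [] = stop noLegalMove
    where
    noLegalMove : ∀ v → legal G S v ≡ false
    noLegalMove v with legal G S v in legal-v
    ... | false = refl
    ... | true with subst (value G f (other p) (insert v S) ∈_) outcomes
                      (∈-map⁺ _ (∈-filter⁺ (λ v → T? (legal G S v)) (∈-allFin v)
                                           (Equivalence.from T-≡ legal-v)))
    ...   | ()
  ... | x ∷ xs with p
  ...   | Maximizer = successors-satisfy P f Maximizer S move
                        (subst (foldr _⊔_ x xs ∈_) (sym outcomes) (foldr-selective-∈ ⊔-sel x xs))
  ...   | Minimizer = successors-satisfy P f Minimizer S move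
                        (subst (foldr _⊓_ x xs ∈_) (sym outcomes) (foldr-selective-∈ ⊓-sel x xs))

  value-elim : ∀ (P : ℕ → Set) → (∀ S → MaximalEnclaveless G S → P ∣ S ∣) →
               ∀ f p S → enclaveless G S ≡ true → n ≤ ∣ S ∣ + f → P (value G f p S)
  value-elim P P-maximal zero p S noEnclave fuel =
    P-maximal S (noEnclave , full⇒noLegalMove G S (subst (n ≤_) (+-identityʳ ∣ S ∣) fuel))
  value-elim P P-maximal (suc f) p S noEnclave fuel =
    value-suc-elim P f p S (λ maximal → P-maximal S (noEnclave , maximal)) move
    where
    move : ∀ v → legal G S v ≡ true → P (value G f (other p) (insert v S))
    move v legal-v = value-elim P P-maximal f (other p) (insert v S) (∧-conicalʳ _ _ legal-v)
      (subst (n ≤_) (trans (+-suc ∣ S ∣ f) (cong (_+ f) (sym (∣insert∣ G v S v∉S)))) fuel)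
      where
      v∉S : v ∈ᵇ S ≡ false
      v∉S = not-injective (∧-conicalˡ _ _ legal-v)

theorem4p1 : (k n : ℕ) → 1 ≤ k → (G : Graph n) → Regular k G →
    (n ≤ 2 * Ψ⁺ G) × (n ≤ 2 * Ψ⁻ G)
theorem4p1 k n k≥1 G regular = atLeastHalf Maximizer , atLeastHalf Minimizer
  where
  atLeastHalf : ∀ p → n ≤ 2 * value G n p emptySet
  atLeastHalf p = value-elim G (λ m → n ≤ 2 * m) (maximalEnclaveless⇒half G k≥1 regular)
                    n p emptySet (enclaveless-∅ G) (m≤n+m n ∣ emptySet {n} ∣)
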